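{- Let $k\ge1$ and $m\ge 2$ be integers. Then $\mathrm{msum}(mk+1,k)\ge k/2$.
   Context: $S_n$ denotes the set of permutations $\pi=(\pi_1,\ldots,\pi_n)$ of $1,\ldots,n$, with indices taken cyclically: $\pi_{n+i}=\pi_i$. For $\pi\in S_n$ and $1\le k<n$ let $s_i=\sum_{j=0}^{k-1}\pi_{i+j}$ for $i=1,\ldots,n$. Define $\mathrm{msum}(\pi,k)=\max\{s_i: 1\le i\le n\}-\frac{k(n+1)}{2}$ and $\mathrm{msum}(n,k)=\min\{\mathrm{msum}(\pi,k):\pi\in S_n\}$. -}

module Defs where

open import Data.Nat using (ℕ; zero; suc; _+_; _*_; _⊔_; NonZero)
open import Data.Fin using (Fin; toℕ)
open import Data.Nat.DivMod using (_mod_)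
open import Data.Nat.ListAction using (sum)
open import Data.List using (List; []; _∷_; map; upTo; foldr)
open import Data.Integer using (ℤ; +_)
open import Data.Rational using (ℚ; _-_; _/_)
open import Function.Bundles using (_↔_; Inverse)

-- A permutation π ∈ S_n, viewed as a bijection on Fin n.
-- Position i (0-based) holds the value π_(i+1) = toℕ (π i) + 1 ∈ {1,…,n}.
Perm : ℕ → Set
Perm n = Fin n ↔ Fin n

-- value π_{j+1} for 0-based position j, indices taken cyclically mod n
val : ∀ {n} .{{_ : NonZero n}} → Perm n → ℕ → ℕ
val {n} π j = suc (toℕ (Inverse.to π (j mod n)))

-- s_{i+1} = π_{i+1} + … + π_{i+k}  (0-based start i)
windowSum : ∀ {n} .{{_ : NonZero n}} → Perm n → ℕ → ℕ → ℕ
windowSum π k i = sum (map (λ j → val π (i + j)) (upTo k))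

maxWindow : ∀ {n} .{{_ : NonZero n}} → Perm n → ℕ → ℕ
maxWindow {n} π k = foldr _⊔_ 0 (map (windowSum π k) (upTo n))

msum : ∀ {n} .{{_ : NonZero n}} → Perm n → ℕ → ℚ
msum {n} π k = ((+ maxWindow π k) / 1) - ((+ (k * (n + 1))) / 2)

-- Let n = mk + 1 and let π be a cyclic arrangement of 1,…,n.  Cut the circle
-- just after the position holding the value 1: the remaining mk positions form
-- m consecutive windows of length k.  Their total is (1 + 2 + … + n) − 1, so the
-- largest window sum M satisfies  n(n+1)/2 ≤ 1 + mM.  Clearing denominators and
-- cancelling m turns this into  k(n+1) + k ≤ 2M, i.e. msum(π,k) ≥ k/2.
module Submission where

open import Defs
open import Data.Nat using (ℕ; zero; suc; _+_; _*_; _∸_; _⊔_; _≤_; NonZero; _%_; >-nonZero⁻¹)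
open import Data.Nat.Properties
open import Data.Nat.DivMod using (_mod_; m%n<n; m<n⇒m%n≡m; [m+n]%n≡m%n; %-distribˡ-+; m%n%n≡m%n)
open import Data.Nat.ListAction using (sum)
open import Data.Nat.Solver using (module +-*-Solver)
open import Data.List using (foldr; applyUpTo)
open import Data.List.Properties using (map-upTo; foldr-preservesᵒ)
open import Data.List.Membership.Propositional using (_∈_)
open import Data.List.Membership.Propositional.Properties using (∈-map⁺; ∈-upTo⁺)
import Data.List.Relation.Unary.Any as Any
open import Data.Sum using (_⊎_; inj₂; [_,_]′)
open import Data.Fin using (Fin; toℕ)
open import Data.Fin.Properties using (toℕ-injective; toℕ-fromℕ<; toℕ<n)
open import Function using (_∘_; Inverse)
open import Relation.Binary.PropositionalEquality
import Algebra.Properties.CommutativeMonoid.Sum as CommutativeMonoidSum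

Σ< : (ℕ → ℕ) → ℕ → ℕ
Σ< g n = sum (applyUpTo g n)

Σ<-cong : ∀ {f g} n → (∀ j → f j ≡ g j) → Σ< f n ≡ Σ< g n
Σ<-cong zero    _ = refl
Σ<-cong (suc n) e = cong₂ _+_ (e 0) (Σ<-cong n (e ∘ suc))

Σ<-last : ∀ g n → Σ< g (suc n) ≡ Σ< g n + g n
Σ<-last g zero    = +-comm (g 0) 0
Σ<-last g (suc n) = trans (cong (g 0 +_) (Σ<-last (g ∘ suc) n)) (sym (+-assoc (g 0) _ _))

Σ<-split : ∀ g a b → Σ< g (a + b) ≡ Σ< g a + Σ< (λ j → g (a + j)) b
Σ<-split g zero    b = refl
Σ<-split g (suc a) b = trans (cong (g 0 +_) (Σ<-split (g ∘ suc) a b)) (sym (+-assoc (g 0) _ _))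

Σ<-blocks : ∀ g k m → Σ< g (m * k) ≡ Σ< (λ t → Σ< (λ j → g (t * k + j)) k) m
Σ<-blocks g k zero    = refl
Σ<-blocks g k (suc m) = trans (Σ<-split g k (m * k)) (cong (Σ< g k +_)
  (trans (Σ<-blocks (λ j → g (k + j)) k m)
         (Σ<-cong m (λ t → Σ<-cong k (λ j → cong g (sym (+-assoc k (t * k) j)))))))

Σ<-rotate₁ : ∀ g n → g n ≡ g 0 → Σ< (g ∘ suc) n ≡ Σ< g n
Σ<-rotate₁ g n gn≡g0 = +-cancelˡ-≡ (g 0) _ _ (begin
  g 0 + Σ< (g ∘ suc) n ≡⟨ Σ<-last g n ⟩
  Σ< g n + g n         ≡⟨ cong (Σ< g n +_) gn≡g0 ⟩
  Σ< g n + g 0         ≡⟨ +-comm (Σ< g n) (g 0) ⟩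
  g 0 + Σ< g n         ∎)
  where open ≡-Reasoning

Σ<-rotate : ∀ g n → (∀ j → g (j + n) ≡ g j) → ∀ p → Σ< (λ j → g (p + j)) n ≡ Σ< g n
Σ<-rotate g n periodic zero    = refl
Σ<-rotate g n periodic (suc p) = begin
  Σ< (λ j → g (suc p + j)) n   ≡⟨ Σ<-cong n (λ j → cong g (sym (+-suc p j))) ⟩
  Σ< (λ j → g (p + suc j)) n   ≡⟨ Σ<-rotate₁ (λ j → g (p + j)) n endpoints ⟩
  Σ< (λ j → g (p + j)) n       ≡⟨ Σ<-rotate g n periodic p ⟩
  Σ< g n                       ∎
  where
  open ≡-Reasoning
  endpoints : g (p + n) ≡ g (p + 0)
  endpoints = trans (periodic p) (cong g (sym (+-identityʳ p)))

Σ<-bound : ∀ g M n → (∀ j → g j ≤ M) → Σ< g n ≤ n * M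
Σ<-bound g M zero    _     = ≤-refl
Σ<-bound g M (suc n) bound = +-mono-≤ (bound 0) (Σ<-bound (g ∘ suc) M n (bound ∘ suc))

Σ<-gauss : ∀ n → 2 * Σ< suc n ≡ n * suc n
Σ<-gauss zero    = refl
Σ<-gauss (suc n) = begin
  2 * Σ< suc (suc n)       ≡⟨ cong (2 *_) (Σ<-last suc n) ⟩
  2 * (Σ< suc n + suc n)   ≡⟨ *-distribˡ-+ 2 (Σ< suc n) (suc n) ⟩
  2 * Σ< suc n + 2 * suc n ≡⟨ cong (_+ 2 * suc n) (Σ<-gauss n) ⟩
  n * suc n + 2 * suc n    ≡⟨ solve 1 (λ n → n :* (con 1 :+ n) :+ con 2 :* (con 1 :+ n)
                                       := (con 1 :+ n) :* (con 2 :+ n)) refl n ⟩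
  suc n * suc (suc n)      ∎
  where
  open ≡-Reasoning
  open +-*-Solver

module FinSum = CommutativeMonoidSum +-0-commutativeMonoid

-- Σ< agrees with the library's sum over Fin n; this gives access to
-- invariance of sums under permutations of the index set.
Σ<-toFinSum : ∀ g n → Σ< g n ≡ FinSum.sum {n} (g ∘ toℕ)
Σ<-toFinSum g zero    = refl
Σ<-toFinSum g (suc n) = cong (g 0 +_) (Σ<-toFinSum (g ∘ suc) n)

≤-foldr-⊔ : ∀ {x} e xs → x ∈ xs → x ≤ foldr _⊔_ e xs
≤-foldr-⊔ {x} e xs x∈xs = foldr-preservesᵒ {P = x ≤_} dominated e xs (inj₂ (Any.map ≤-reflexive x∈xs))
  where
  dominated : ∀ a b → x ≤ a ⊎ x ≤ b → x ≤ a ⊔ b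
  dominated a b = [ (λ x≤a → ≤-trans x≤a (m≤m⊔n a b)) , (λ x≤b → ≤-trans x≤b (m≤n⊔m a b)) ]′

module CyclicValues {n : ℕ} {{_ : NonZero n}} (π : Perm n) where
  open Inverse π

  toℕ-mod : ∀ a → toℕ (a mod n) ≡ a % n
  toℕ-mod a = toℕ-fromℕ< (m%n<n a n)

  val-mod : ∀ a b → a % n ≡ b % n → val π a ≡ val π b
  val-mod a b a≡b = cong (suc ∘ toℕ ∘ to) (toℕ-injective (trans (toℕ-mod a) (trans a≡b (sym (toℕ-mod b)))))

  val-periodic : ∀ j → val π (j + n) ≡ val π j
  val-periodic j = val-mod (j + n) j ([m+n]%n≡m%n j n)

  mod-Fin : ∀ (i : Fin n) → toℕ i mod n ≡ i
  mod-Fin i = toℕ-injective (trans (toℕ-mod (toℕ i)) (m<n⇒m%n≡m (toℕ<n i)))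

  val-total : Σ< (val π) n ≡ Σ< suc n
  val-total = begin
    Σ< (val π) n                        ≡⟨ Σ<-toFinSum (val π) n ⟩
    ∑ (λ i → suc (toℕ (to (toℕ i mod n)))) ≡⟨ FinSum.sum-cong-≗ (λ i → cong (suc ∘ toℕ ∘ to) (mod-Fin i)) ⟩
    ∑ (λ i → suc (toℕ (to i)))          ≡⟨ FinSum.∑-permute (suc ∘ toℕ) π ⟨
    ∑ (suc ∘ toℕ)                       ≡⟨ Σ<-toFinSum suc n ⟨
    Σ< suc n                            ∎
    where
    open ≡-Reasoning
    ∑ : (Fin n → ℕ) → ℕ
    ∑ = FinSum.sum {n}

  positionOfOne : Fin n
  positionOfOne = from (0 mod n)

  val-positionOfOne : val π (toℕ positionOfOne) ≡ 1
  val-positionOfOne = begin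
    suc (toℕ (to (toℕ positionOfOne mod n))) ≡⟨ cong (suc ∘ toℕ ∘ to) (mod-Fin positionOfOne) ⟩
    suc (toℕ (to (from (0 mod n))))          ≡⟨ cong (suc ∘ toℕ) (strictlyInverseˡ (0 mod n)) ⟩
    suc (toℕ (0 mod n))                      ≡⟨ cong suc (toℕ-mod 0) ⟩
    suc (0 % n)                              ≡⟨ cong suc (m<n⇒m%n≡m (>-nonZero⁻¹ n)) ⟩
    1                                        ∎
    where open ≡-Reasoning

  windowSum-Σ< : ∀ k i → windowSum π k i ≡ Σ< (λ j → val π (i + j)) k
  windowSum-Σ< k i = cong sum (map-upTo (λ j → val π (i + j)) k)

  -- Window sums, with an arbitrary start, are bounded by the maximal window
  -- sum, which only ranges over the starts 0,…,n−1.
  window-≤-max : ∀ k i → windowSum π k i ≤ maxWindow π k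
  window-≤-max k i = ≤-trans (≤-reflexive window-reduce)
    (≤-foldr-⊔ 0 _ (∈-map⁺ (windowSum π k) (∈-upTo⁺ (m%n<n i n))))
    where
    shift-mod : ∀ j → (i + j) % n ≡ (i % n + j) % n
    shift-mod j = trans (%-distribˡ-+ i j n)
      (trans (cong (λ r → (r + j % n) % n) (sym (m%n%n≡m%n i n))) (sym (%-distribˡ-+ (i % n) j n)))
    window-reduce : windowSum π k i ≡ windowSum π k (i % n)
    window-reduce = trans (windowSum-Σ< k i)
      (trans (Σ<-cong k (λ j → val-mod _ _ (shift-mod j))) (sym (windowSum-Σ< k (i % n))))

  windows-partition : ∀ m k s → Σ< (λ j → val π (s + j)) (m * k) ≡ Σ< (λ t → windowSum π k (s + t * k)) m
  windows-partition m k s = trans (Σ<-blocks (λ j → val π (s + j)) k m)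
    (Σ<-cong m (λ t → trans (Σ<-cong k (λ j → cong (val π) (sym (+-assoc s (t * k) j))))
                            (sym (windowSum-Σ< k (s + t * k)))))

windows-cover : ∀ m k (π : Perm (suc (m * k))) → Σ< suc (suc (m * k)) ≤ 1 + m * maxWindow π k
windows-cover m k π = begin
  Σ< suc (suc N)                                  ≡⟨ val-total ⟨
  Σ< (val π) (suc N)                              ≡⟨ Σ<-rotate (val π) (suc N) val-periodic q ⟨
  Σ< (λ j → val π (q + j)) (suc N)                ≡⟨ cong₂ _+_ value-one (Σ<-cong N (λ j → cong (val π) (+-suc q j))) ⟩
  1 + Σ< (λ j → val π (suc q + j)) N              ≡⟨ cong (1 +_) (windows-partition m k (suc q)) ⟩
  1 + Σ< (λ t → windowSum π k (suc q + t * k)) m  ≤⟨ +-monoʳ-≤ 1 (Σ<-bound _ _ m (λ t → window-≤-max k (suc q + t * k))) ⟩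
  1 + m * maxWindow π k                           ∎
  where
  open ≤-Reasoning
  N = m * k
  open CyclicValues π
  q = toℕ positionOfOne
  value-one : val π (q + 0) ≡ 1
  value-one = trans (cong (val π) (+-identityʳ q)) val-positionOfOne

window-arithmetic : ∀ m k M .{{_ : NonZero m}} →
  Σ< suc (suc (m * k)) ≤ 1 + m * M → k + k * (suc (m * k) + 1) ≤ M * 2
window-arithmetic m@(suc _) k M cover = *-cancelˡ-≤ m (+-cancelˡ-≤ 2 _ _ (begin
  2 + m * (k + k * (suc N + 1)) ≡⟨ solve 2 (λ m k → con 2 :+ m :* (k :+ k :* ((con 1 :+ m :* k) :+ con 1))
                                      := (con 1 :+ m :* k) :* (con 2 :+ m :* k)) refl m k ⟩
  suc N * suc (suc N)           ≡⟨ Σ<-gauss (suc N) ⟨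
  2 * Σ< suc (suc N)            ≤⟨ *-monoʳ-≤ 2 cover ⟩
  2 * (1 + m * M)               ≡⟨ solve 2 (λ m w → con 2 :* (con 1 :+ m :* w) := con 2 :+ m :* (w :* con 2)) refl m M ⟩
  2 + m * (M * 2)               ∎))
  where
  open ≤-Reasoning
  open +-*-Solver
  N = m * k

-- The integer and rational imports come after the ℕ development: the prefix
-- operator +_ of ℤ would make ℕ sections such as (x +_) ambiguous.
open import Data.Integer as ℤ using (+_)
import Data.Integer.Properties as ℤP
open import Data.Rational using (_/_; _-_; toℚᵘ) renaming (_≤_ to _≤ℚ_; -_ to -ℚ_)
open import Data.Rational.Properties using (toℚᵘ-cancel-≤; toℚᵘ-fromℚᵘ; toℚᵘ-homo-+; toℚᵘ-homo‿-)
import Data.Rational.Unnormalised as ℚᵘ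
import Data.Rational.Unnormalised.Properties as ℚᵘP

-- The integer inequality behind a/2 ≤ M − K/2: over the common denominator 2
-- the right-hand numerator is 2M − K, which is at least a.
cross-multiplied : ∀ a K M → a + K ≤ M * 2 →
  + a ℤ.* + 2 ℤ.≤ (+ M ℤ.* + 2 ℤ.+ ℤ.- (+ K) ℤ.* + 1) ℤ.* + 2
cross-multiplied a K M a+K≤2M =
  subst₂ ℤ._≤_ (ℤP.pos-* a 2) (trans (ℤP.pos-* (M * 2 ∸ K) 2) (cong (ℤ._* + 2) (sym numerator)))
    (ℤ.+≤+ (*-monoˡ-≤ 2 (m+n≤o⇒m≤o∸n a a+K≤2M)))
  where
  numerator : + M ℤ.* + 2 ℤ.+ ℤ.- (+ K) ℤ.* + 1 ≡ + (M * 2 ∸ K)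
  numerator = begin
    + M ℤ.* + 2 ℤ.+ ℤ.- (+ K) ℤ.* + 1 ≡⟨ cong₂ ℤ._+_ (sym (ℤP.pos-* M 2)) (ℤP.*-identityʳ (ℤ.- (+ K))) ⟩
    + (M * 2) ℤ.+ ℤ.- (+ K)           ≡⟨ ℤP.m-n≡m⊖n (M * 2) K ⟩
    (M * 2) ℤ.⊖ K                     ≡⟨ ℤP.⊖-≥ (m+n≤o⇒n≤o a a+K≤2M) ⟩
    + (M * 2 ∸ K)                     ∎
    where open ≡-Reasoning

-- Passing to ℚ: if a + K ≤ 2M then a/2 ≤ M − K/2.  The comparison is carried
-- out on unnormalised fractions, where it is the integer inequality above.
half-≤-difference : ∀ a K M → a + K ≤ M * 2 → (+ a / 2) ≤ℚ ((+ M / 1) - (+ K / 2))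
half-≤-difference a K M a+K≤2M = toℚᵘ-cancel-≤ (begin
  toℚᵘ (+ a / 2)                                ≃⟨ toℚᵘ-fromℚᵘ (ℚᵘ.mkℚᵘ (+ a) 1) ⟩
  ℚᵘ.mkℚᵘ (+ a) 1                               ≤⟨ ℚᵘ.*≤* (cross-multiplied a K M a+K≤2M) ⟩
  ℚᵘ.mkℚᵘ (+ M) 0 ℚᵘ.+ ℚᵘ.- ℚᵘ.mkℚᵘ (+ K) 1     ≃⟨ ℚᵘP.+-cong (toℚᵘ-fromℚᵘ (ℚᵘ.mkℚᵘ (+ M) 0))
                                                                (ℚᵘP.-‿cong (toℚᵘ-fromℚᵘ (ℚᵘ.mkℚᵘ (+ K) 1))) ⟨
  toℚᵘ (+ M / 1) ℚᵘ.+ ℚᵘ.- toℚᵘ (+ K / 2)       ≃⟨ ℚᵘP.+-congʳ (toℚᵘ (+ M / 1)) (toℚᵘ-homo‿- (+ K / 2)) ⟨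
  toℚᵘ (+ M / 1) ℚᵘ.+ toℚᵘ (-ℚ (+ K / 2))       ≃⟨ toℚᵘ-homo-+ (+ M / 1) (-ℚ (+ K / 2)) ⟨
  toℚᵘ ((+ M / 1) - (+ K / 2))                  ∎)
  where open ℚᵘP.≤-Reasoning

-- Lemma 3.1: msum(mk+1, k) ≥ k/2.
lemma3p1 : (k m : ℕ) → 1 ≤ k → 2 ≤ m →
    (π : Perm (suc (m * k))) → ((+ k) / 2) ≤ℚ msum π k
lemma3p1 k zero      _ () π
lemma3p1 k m@(suc _) _ _  π =
  half-≤-difference k (k * (suc (m * k) + 1)) (maxWindow π k)
    (window-arithmetic m k (maxWindow π k) (windows-cover m k π))
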